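{- For every positive integer $n$ with $n \equiv 0 \pmod 4$ or $n \equiv 1 \pmod 4$, the transitive tournament $TT_n$ admits a chain--collider--fork decomposition consisting of exactly $\left\lfloor \frac{n}{4}\right\rfloor$ colliders, $\frac{n(n-1)}{4}-\left\lfloor \frac{n}{4}\right\rfloor$ forks, and $0$ chains.
   Context: The transitive tournament $TT_n$ has vertex set $\{v_1,\dots,v_n\}$ and arc set $\{(v_i,v_j): 1\le i<j\le n\}$ (an arc $(u,v)$ is written $u\to v$). A chain is a digraph on three distinct vertices with arcs $a\to b\to c$; a collider is one with arcs $a\to b\leftarrow c$; a fork is one with arcs $a\leftarrow b\to c$. A chain--collider--fork decomposition of $TT_n$ is a partition of the arc set of $TT_n$ into two-element sets of arcs, each of which forms (as a subdigraph) a chain, a collider, or a fork. -}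

module Defs where

open import Data.Nat using (ℕ; _<_; _/_; _*_; _∸_; _+_)
open import Data.Fin using (Fin; toℕ; _<?_)
open import Data.Fin.Base using () renaming (_<_ to _<ᶠ_)
open import Data.List using (List; []; _∷_; filter; length; concatMap; allFin; map; _++_)
open import Data.List.Relation.Unary.All using (All)
open import Data.List.Relation.Binary.Permutation.Propositional using (_↭_)
open import Data.Product using (_×_; _,_; proj₁; proj₂; Σ)
open import Relation.Binary.PropositionalEquality using (_≡_; _≢_)

-- An arc u → v of a digraph on vertex set Fin n is the ordered pair (u , v).
Arc : ℕ → Set
Arc n = Fin n × Fin n

ttArcs : (n : ℕ) → List (Arc n)
ttArcs n = concatMap (λ i → map (λ j → (i , j)) (filter (λ j → i <? j) (allFin n))) (allFin n)

Distinct3 : ∀ {n} → Fin n → Fin n → Fin n → Set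
Distinct3 a b c = (a ≢ b) × (b ≢ c) × (a ≢ c)

-- A two-element set of arcs {e₁ , e₂} (stored as an ordered pair).
-- chain:    a → b → c
-- collider: a → b ← c
-- fork:     a ← b → c
-- (each on three distinct vertices a, b, c)
IsChain : ∀ {n} → Arc n → Arc n → Set
IsChain {n} e₁ e₂ = Σ (Fin n) λ a → Σ (Fin n) λ b → Σ (Fin n) λ c →
  Distinct3 a b c × (((e₁ ≡ (a , b)) × (e₂ ≡ (b , c))) Data.Sum.⊎ ((e₁ ≡ (b , c)) × (e₂ ≡ (a , b))))
  where import Data.Sum

IsCollider : ∀ {n} → Arc n → Arc n → Set
IsCollider {n} e₁ e₂ = Σ (Fin n) λ a → Σ (Fin n) λ b → Σ (Fin n) λ c →
  Distinct3 a b c × (e₁ ≡ (a , b)) × (e₂ ≡ (c , b))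

IsFork : ∀ {n} → Arc n → Arc n → Set
IsFork {n} e₁ e₂ = Σ (Fin n) λ a → Σ (Fin n) λ b → Σ (Fin n) λ c →
  Distinct3 a b c × (e₁ ≡ (b , a)) × (e₂ ≡ (b , c))

data Kind : Set where
  chain collider fork : Kind

HasKind : ∀ {n} → Kind → Arc n × Arc n → Set
HasKind chain    (e₁ , e₂) = IsChain e₁ e₂
HasKind collider (e₁ , e₂) = IsCollider e₁ e₂
HasKind fork     (e₁ , e₂) = IsFork e₁ e₂

Block : ℕ → Set
Block n = Kind × (Arc n × Arc n)

blockArcs : ∀ {n} → List (Block n) → List (Arc n)
blockArcs [] = []
blockArcs ((_ , (e₁ , e₂)) ∷ bs) = e₁ ∷ e₂ ∷ blockArcs bs

count : ∀ {n} → Kind → List (Block n) → ℕ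
count k [] = 0
count chain    ((chain , _) ∷ bs) = 1 + count chain bs
count collider ((collider , _) ∷ bs) = 1 + count collider bs
count fork     ((fork , _) ∷ bs) = 1 + count fork bs
count k (_ ∷ bs) = count k bs

-- A chain–collider–fork decomposition of TT_n: a list of blocks, each block
-- really being of its stated kind, whose arcs (listed with multiplicity) are
-- a permutation of the arcs of TT_n (i.e. the blocks partition the arc set).
record CCFDecomposition (n : ℕ) : Set where
  field
    blocks    : List (Block n)
    wellKind  : All (λ b → HasKind (proj₁ b) (proj₂ b)) blocks
    partition : blockArcs blocks ↭ ttArcs n

{-# OPTIONS --safe #-}
-- TT_{n+1} is TT_n below a new source v₀ whose n out-arcs, when n is even, pair
-- up into forks at v₀.  Going from TT_{4k+1} to TT_{4k+4} adds three sources
-- v₂, v₁, v₀ above the old top vertex v₃; v₁ has even out-degree, while the odd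
-- out-degrees of v₀ and v₂ are repaired by the fork v₁ ← v₀ → v₂ and the
-- collider v₀ → v₃ ← v₂.  That gives k colliders in TT_{4k} and TT_{4k+1}, no
-- chains, and counting arcs forces the number of forks.
module Submission where

open import Defs
open import Data.Bool using (true; false)
open import Data.Nat using (ℕ; zero; suc; NonZero; _%_; _/_; _*_; _∸_; _+_; _<ᵇ_; z<s)
open import Data.Nat.Properties using (+-suc; +-assoc; *-assoc; *-distribʳ-+; m+n∸m≡n)
open import Data.Nat.DivMod using (m*n/n≡m; m≡m%n+[m/n]*n)
open import Data.Nat.Tactic.RingSolver using (solve-∀)
open import Data.Fin using (Fin; zero; suc; _<?_; toℕ)
import Data.Fin.Properties as Fin
open import Data.List using (List; []; _∷_; _++_; map; filter; concatMap; allFin; tabulate; length)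
open import Data.List.Properties
  using ( map-tabulate; map-∘; concatMap-map; concatMap-cong; map-concatMap; filter-all
        ; length-++; length-map; length-tabulate)
open import Data.List.Relation.Unary.All using (All; []; _∷_)
import Data.List.Relation.Unary.All as All
import Data.List.Relation.Unary.All.Properties as All
open import Data.List.Relation.Binary.Permutation.Propositional
  using (_↭_; ↭-refl; ↭-sym; ↭-trans; ↭-reflexive; prep)
import Data.List.Relation.Binary.Permutation.Propositional.Properties as ↭
open import Data.Product using (Σ; _×_; _,_; proj₁; proj₂)
open import Data.Sum using (_⊎_; inj₁; inj₂)
open import Function using (_∘_; id)
open import Function.Definitions using (Injective)
open import Relation.Binary.PropositionalEquality
open ≡-Reasoning

-- TT_n sits in TT_{n+1} as the vertices below the new source zero.
liftArc : ∀ {n} → Arc n → Arc (suc n)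
liftArc (a , b) = suc a , suc b

sourceArcs : ∀ n → List (Arc (suc n))
sourceArcs n = tabulate (λ j → zero , suc j)

outArcs : ∀ {n} → Fin n → List (Arc n)
outArcs {n} i = map (i ,_) (filter (i <?_) (allFin n))

-- suc i <? suc x and i <? x both decide by computing toℕ i <ᵇ toℕ x.
filter-suc<? : ∀ {n} (i : Fin n) (xs : List (Fin n)) →
  filter (suc i <?_) (map suc xs) ≡ map suc (filter (i <?_) xs)
filter-suc<? i []       = refl
filter-suc<? i (x ∷ xs) with toℕ i <ᵇ toℕ x
... | true  = cong (suc x ∷_) (filter-suc<? i xs)
... | false = filter-suc<? i xs

outArcs-zero : ∀ n → outArcs {suc n} zero ≡ sourceArcs n
outArcs-zero n = begin
  outArcs zero                  ≡⟨ cong (map (zero ,_)) (filter-all (zero {n} <?_) (All.tabulate⁺ λ _ → z<s)) ⟩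
  map (zero ,_) (tabulate suc)  ≡⟨ map-tabulate suc (zero ,_) ⟩
  sourceArcs n                  ∎

outArcs-suc : ∀ {n} (i : Fin n) → outArcs (suc i) ≡ map liftArc (outArcs i)
outArcs-suc {n} i = begin
  map (suc i ,_) (filter (suc i <?_) (tabulate suc))
    ≡⟨ cong (map (suc i ,_) ∘ filter (suc i <?_)) (map-tabulate id suc) ⟨
  map (suc i ,_) (filter (suc i <?_) (map suc (allFin n)))
    ≡⟨ cong (map (suc i ,_)) (filter-suc<? i (allFin n)) ⟩
  map (suc i ,_) (map suc (filter (i <?_) (allFin n)))
    ≡⟨ map-∘ _ ⟨
  map (liftArc ∘ (i ,_)) (filter (i <?_) (allFin n))
    ≡⟨ map-∘ _ ⟩
  map liftArc (outArcs i)
    ∎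

ttArcs-suc : ∀ n → ttArcs (suc n) ≡ sourceArcs n ++ map liftArc (ttArcs n)
ttArcs-suc n = cong₂ _++_ (outArcs-zero n) (begin
  concatMap outArcs (tabulate suc)              ≡⟨ cong (concatMap outArcs) (map-tabulate id suc) ⟨
  concatMap outArcs (map suc (allFin n))        ≡⟨ concatMap-map outArcs suc (allFin n) ⟩
  concatMap (outArcs ∘ suc) (allFin n)          ≡⟨ concatMap-cong outArcs-suc (allFin n) ⟩
  concatMap (map liftArc ∘ outArcs) (allFin n)  ≡⟨ map-concatMap liftArc outArcs (allFin n) ⟨
  map liftArc (ttArcs n)                        ∎)

ttArcs-suc³ : ∀ n → ttArcs (suc (suc (suc n))) ≡
  sourceArcs (suc (suc n)) ++ map liftArc (sourceArcs (suc n) ++ map liftArc (sourceArcs n ++ map liftArc (ttArcs n)))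
ttArcs-suc³ n =
  trans (ttArcs-suc (suc (suc n)))
        (cong (λ l → sourceArcs (suc (suc n)) ++ map liftArc l)
              (trans (ttArcs-suc (suc n)) (cong (λ l → sourceArcs (suc n) ++ map liftArc l) (ttArcs-suc n))))

length-ttArcs-suc : ∀ n → length (ttArcs (suc n)) ≡ n + length (ttArcs n)
length-ttArcs-suc n = begin
  length (ttArcs (suc n))                                  ≡⟨ cong length (ttArcs-suc n) ⟩
  length (sourceArcs n ++ map liftArc (ttArcs n))          ≡⟨ length-++ (sourceArcs n) ⟩
  length (sourceArcs n) + length (map liftArc (ttArcs n))  ≡⟨ cong₂ _+_ (length-tabulate _) (length-map liftArc (ttArcs n)) ⟩
  n + length (ttArcs n)                                    ∎

length-ttArcs : ∀ n → length (ttArcs n) * 2 ≡ n * (n ∸ 1)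
length-ttArcs zero    = refl
length-ttArcs (suc n) = begin
  length (ttArcs (suc n)) * 2    ≡⟨ cong (_* 2) (length-ttArcs-suc n) ⟩
  (n + length (ttArcs n)) * 2    ≡⟨ *-distribʳ-+ 2 n (length (ttArcs n)) ⟩
  n * 2 + length (ttArcs n) * 2  ≡⟨ cong (n * 2 +_) (length-ttArcs n) ⟩
  n * 2 + n * (n ∸ 1)            ≡⟨ gauss n ⟩
  suc n * n                      ∎
  where
  gauss-suc : ∀ m → suc m * 2 + suc m * m ≡ suc (suc m) * suc m
  gauss-suc = solve-∀
  gauss : ∀ m → m * 2 + m * (m ∸ 1) ≡ suc m * m
  gauss zero    = refl
  gauss (suc m) = gauss-suc m

liftBlock : ∀ {n} → Block n → Block (suc n)
liftBlock (k , e₁ , e₂) = k , liftArc e₁ , liftArc e₂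

blockArcs-++ : ∀ {n} (bs cs : List (Block n)) → blockArcs (bs ++ cs) ≡ blockArcs bs ++ blockArcs cs
blockArcs-++ []                   cs = refl
blockArcs-++ ((_ , e₁ , e₂) ∷ bs) cs = cong (λ l → e₁ ∷ e₂ ∷ l) (blockArcs-++ bs cs)

blockArcs-lift : ∀ {n} (bs : List (Block n)) → blockArcs (map liftBlock bs) ≡ map liftArc (blockArcs bs)
blockArcs-lift []                   = refl
blockArcs-lift ((_ , e₁ , e₂) ∷ bs) = cong (λ l → liftArc e₁ ∷ liftArc e₂ ∷ l) (blockArcs-lift bs)

length-blockArcs : ∀ {n} (bs : List (Block n)) → length (blockArcs bs) ≡ length bs * 2
length-blockArcs []       = refl
length-blockArcs (_ ∷ bs) = cong (λ l → suc (suc l)) (length-blockArcs bs)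

count-∷ : ∀ {m n} k k′ (e : Arc n × Arc n) (e′ : Arc m × Arc m) bs →
  count k ((k′ , e) ∷ bs) ≡ count k ((k′ , e′) ∷ []) + count k bs
count-∷ chain    chain    _ _ _ = refl
count-∷ chain    collider _ _ _ = refl
count-∷ chain    fork     _ _ _ = refl
count-∷ collider chain    _ _ _ = refl
count-∷ collider collider _ _ _ = refl
count-∷ collider fork     _ _ _ = refl
count-∷ fork     chain    _ _ _ = refl
count-∷ fork     collider _ _ _ = refl
count-∷ fork     fork     _ _ _ = refl

count-++ : ∀ {n} k (bs cs : List (Block n)) → count k (bs ++ cs) ≡ count k bs + count k cs
count-++ k []              cs = refl
count-++ k ((k′ , e) ∷ bs) cs = begin
  count k ((k′ , e) ∷ bs ++ cs)   ≡⟨ count-∷ k k′ e e (bs ++ cs) ⟩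
  head + count k (bs ++ cs)       ≡⟨ cong (head +_) (count-++ k bs cs) ⟩
  head + (count k bs + count k cs) ≡⟨ +-assoc head _ _ ⟨
  head + count k bs + count k cs  ≡⟨ cong (_+ count k cs) (count-∷ k k′ e e bs) ⟨
  count k ((k′ , e) ∷ bs) + count k cs ∎
  where
  head : ℕ
  head = count k ((k′ , e) ∷ [])

count-lift : ∀ {n} k (bs : List (Block n)) → count k (map liftBlock bs) ≡ count k bs
count-lift k []                    = refl
count-lift k ((k′ , e₁ , e₂) ∷ bs) = begin
  count k ((k′ , liftArc e₁ , liftArc e₂) ∷ map liftBlock bs)  ≡⟨ count-∷ k k′ _ (e₁ , e₂) _ ⟩
  head + count k (map liftBlock bs)                            ≡⟨ cong (head +_) (count-lift k bs) ⟩
  head + count k bs                                            ≡⟨ count-∷ k k′ (e₁ , e₂) (e₁ , e₂) bs ⟨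
  count k ((k′ , e₁ , e₂) ∷ bs)                                ∎
  where
  head : ℕ
  head = count k ((k′ , e₁ , e₂) ∷ [])

length≡counts : ∀ {n} (bs : List (Block n)) → length bs ≡ count chain bs + count collider bs + count fork bs
length≡counts []                  = refl
length≡counts ((chain , _) ∷ bs)    = cong suc (length≡counts bs)
length≡counts ((collider , _) ∷ bs) =
  trans (cong suc (length≡counts bs)) (cong (_+ count fork bs) (sym (+-suc (count chain bs) (count collider bs))))
length≡counts ((fork , _) ∷ bs)     =
  trans (cong suc (length≡counts bs)) (sym (+-suc (count chain bs + count collider bs) (count fork bs)))

distinct3-suc : ∀ {n} {a b c : Fin n} → Distinct3 a b c → Distinct3 (suc a) (suc b) (suc c)
distinct3-suc (a≢b , b≢c , a≢c) = a≢b ∘ Fin.suc-injective , b≢c ∘ Fin.suc-injective , a≢c ∘ Fin.suc-injective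

hasKind-lift : ∀ {n} (b : Block n) → HasKind (proj₁ b) (proj₂ b) →
  HasKind (proj₁ (liftBlock b)) (proj₂ (liftBlock b))
hasKind-lift (chain , _)    (a , b , c , d , inj₁ (refl , refl)) =
  suc a , suc b , suc c , distinct3-suc d , inj₁ (refl , refl)
hasKind-lift (chain , _)    (a , b , c , d , inj₂ (refl , refl)) =
  suc a , suc b , suc c , distinct3-suc d , inj₂ (refl , refl)
hasKind-lift (collider , _) (a , b , c , d , refl , refl) = suc a , suc b , suc c , distinct3-suc d , refl , refl
hasKind-lift (fork , _)     (a , b , c , d , refl , refl) = suc a , suc b , suc c , distinct3-suc d , refl , refl

WellKinded : ∀ {n} → List (Block n) → Set
WellKinded = All (λ b → HasKind (proj₁ b) (proj₂ b))

wellKinded-lift : ∀ {n} {bs : List (Block n)} → WellKinded bs → WellKinded (map liftBlock bs)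
wellKinded-lift = All.map⁺ ∘ All.map (hasKind-lift _)

record FCDecomposition {n} (xs : List (Arc n)) (c : ℕ) : Set where
  field
    blocks    : List (Block n)
    wellKind  : WellKinded blocks
    partition : blockArcs blocks ↭ xs
    colliders : count collider blocks ≡ c
    noChains  : count chain blocks ≡ 0

open FCDecomposition

empty : ∀ {n} → FCDecomposition {n} [] 0
empty = record { blocks = [] ; wellKind = [] ; partition = ↭-refl ; colliders = refl ; noChains = refl }

infixr 5 _⊕_

_⊕_ : ∀ {n} {xs ys : List (Arc n)} {c d} →
  FCDecomposition xs c → FCDecomposition ys d → FCDecomposition (xs ++ ys) (c + d)
D ⊕ E = record
  { blocks    = blocks D ++ blocks E
  ; wellKind  = All.++⁺ (wellKind D) (wellKind E)
  ; partition = ↭-trans (↭-reflexive (blockArcs-++ (blocks D) (blocks E))) (↭.++⁺ (partition D) (partition E))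
  ; colliders = trans (count-++ collider (blocks D) (blocks E)) (cong₂ _+_ (colliders D) (colliders E))
  ; noChains  = trans (count-++ chain (blocks D) (blocks E)) (cong₂ _+_ (noChains D) (noChains E))
  }

lift : ∀ {n} {xs : List (Arc n)} {c} → FCDecomposition xs c → FCDecomposition (map liftArc xs) c
lift D = record
  { blocks    = map liftBlock (blocks D)
  ; wellKind  = wellKinded-lift (wellKind D)
  ; partition = ↭-trans (↭-reflexive (blockArcs-lift (blocks D))) (↭.map⁺ liftArc (partition D))
  ; colliders = trans (count-lift collider (blocks D)) (colliders D)
  ; noChains  = trans (count-lift chain (blocks D)) (noChains D)
  }

reorder : ∀ {n} {xs ys : List (Arc n)} {c} → xs ↭ ys → FCDecomposition xs c → FCDecomposition ys c
reorder xs↭ys D = record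
  { blocks = blocks D ; wellKind = wellKind D ; partition = ↭-trans (partition D) xs↭ys
  ; colliders = colliders D ; noChains = noChains D }

singleFork : ∀ {n} {a b c : Fin n} → Distinct3 a b c → FCDecomposition ((b , a) ∷ (b , c) ∷ []) 0
singleFork {a = a} {b} {c} d = record
  { blocks = (fork , (b , a) , (b , c)) ∷ [] ; wellKind = (a , b , c , d , refl , refl) ∷ []
  ; partition = ↭-refl ; colliders = refl ; noChains = refl }

singleCollider : ∀ {n} {a b c : Fin n} → Distinct3 a b c → FCDecomposition ((a , b) ∷ (c , b) ∷ []) 1
singleCollider {a = a} {b} {c} d = record
  { blocks = (collider , (a , b) , (c , b)) ∷ [] ; wellKind = (a , b , c , d , refl , refl) ∷ []
  ; partition = ↭-refl ; colliders = refl ; noChains = refl }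

-- Indexing the targets by Fin (q * 2) makes the pairing into forks structural.
topFan : ∀ {n} q (g : Fin (q * 2) → Fin n) → Injective _≡_ _≡_ g →
  FCDecomposition (tabulate (λ j → zero {n} , suc (g j))) 0
topFan zero    g g-inj = empty
topFan (suc q) g g-inj =
  singleFork distinct ⊕ topFan q (λ j → g (suc (suc j))) (Fin.suc-injective ∘ Fin.suc-injective ∘ g-inj)
  where
  zero≢one : zero {suc (q * 2)} ≢ suc zero
  zero≢one ()
  distinct : Distinct3 (suc (g zero)) zero (suc (g (suc zero)))
  distinct = (λ ()) , (λ ()) , zero≢one ∘ g-inj ∘ Fin.suc-injective

addEvenSource : ∀ q {c} → FCDecomposition (ttArcs (q * 2)) c → FCDecomposition (ttArcs (suc (q * 2))) c
addEvenSource q D = reorder (↭-reflexive (sym (ttArcs-suc (q * 2)))) (topFan q id id ⊕ lift D)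

shift-lift² : ∀ {n} (x : Arc n) A B C →
  liftArc (liftArc x) ∷ A ++ map liftArc (B ++ map liftArc C) ↭ A ++ map liftArc (B ++ map liftArc (x ∷ C))
shift-lift² x A B C =
  ↭-sym (↭-trans (↭.++⁺ˡ A (↭.map⁺ liftArc (↭.shift (liftArc x) B _))) (↭.shift _ A _))

-- The collider arc 2 → 3 is the first out-arc (0 , 1) of the source of TT_{q*2+2},
-- lifted twice; shift-lift² moves it back there.
addThreeSources : ∀ q {c} →
  FCDecomposition (ttArcs (suc (q * 2))) c → FCDecomposition (ttArcs (suc (suc q) * 2)) (suc c)
addThreeSources q D = reorder
  (↭-trans (prep _ (prep _ (prep _ (shift-lift² (zero , suc zero) A B C))))
           (↭-reflexive (sym (ttArcs-suc³ (suc (q * 2))))))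
  (singleFork {a = suc zero} {zero} {suc (suc zero)} ((λ ()) , (λ ()) , (λ ()))
   ⊕ singleCollider {a = zero} {suc (suc (suc zero))} {suc (suc zero)} ((λ ()) , (λ ()) , (λ ()))
   ⊕ topFan q (λ j → suc (suc (suc j))) (Fin.suc-injective ∘ Fin.suc-injective ∘ Fin.suc-injective)
   ⊕ lift (topFan (suc q) id id ⊕ lift (topFan q suc Fin.suc-injective ⊕ lift D)))
  where
  A : List (Arc (suc (suc (suc (suc (q * 2))))))
  A = tabulate (λ j → zero , suc (suc (suc (suc j))))
  B : List (Arc (suc (suc (suc (q * 2)))))
  B = sourceArcs (suc (suc (q * 2)))
  C : List (Arc (suc (suc (q * 2))))
  C = tabulate (λ j → zero , suc (suc j)) ++ map liftArc (ttArcs (suc (q * 2)))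

decomposition-4k : ∀ k → FCDecomposition (ttArcs ((k * 2) * 2)) k
decomposition-4k zero    = empty
decomposition-4k (suc k) = addThreeSources (k * 2) (addEvenSource (k * 2) (decomposition-4k k))

decomposition : ∀ n → n % 4 ≡ 0 ⊎ n % 4 ≡ 1 → FCDecomposition (ttArcs n) (n / 4)
decomposition n residue = subst (λ m → FCDecomposition (ttArcs m) (n / 4)) (sym n≡) (by-residue residue)
  where
  n≡ : n ≡ n % 4 + (n / 4 * 2) * 2
  n≡ = trans (m≡m%n+[m/n]*n n 4) (cong (n % 4 +_) (sym (*-assoc (n / 4) 2 2)))
  by-residue : n % 4 ≡ 0 ⊎ n % 4 ≡ 1 → FCDecomposition (ttArcs (n % 4 + (n / 4 * 2) * 2)) (n / 4)
  by-residue (inj₁ r≡0) rewrite r≡0 = decomposition-4k (n / 4)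
  by-residue (inj₂ r≡1) rewrite r≡1 = addEvenSource (n / 4 * 2) (decomposition-4k (n / 4))

toCCF : ∀ {n c} → FCDecomposition (ttArcs n) c → CCFDecomposition n
toCCF D = record { blocks = blocks D ; wellKind = wellKind D ; partition = partition D }

length-ccf-blocks : ∀ {n} (D : CCFDecomposition n) → length (CCFDecomposition.blocks D) * 4 ≡ n * (n ∸ 1)
length-ccf-blocks {n} D = begin
  length bs * 4              ≡⟨ *-assoc (length bs) 2 2 ⟨
  length bs * 2 * 2          ≡⟨ cong (_* 2) (length-blockArcs bs) ⟨
  length (blockArcs bs) * 2  ≡⟨ cong (_* 2) (↭.↭-length (CCFDecomposition.partition D)) ⟩
  length (ttArcs n) * 2      ≡⟨ length-ttArcs n ⟩
  n * (n ∸ 1)                ∎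
  where
  bs : List (Block n)
  bs = CCFDecomposition.blocks D

count-fork-ccf : ∀ {n c} (D : CCFDecomposition n) → let bs = CCFDecomposition.blocks D in
  count chain bs ≡ 0 → count collider bs ≡ c → count fork bs ≡ n * (n ∸ 1) / 4 ∸ c
count-fork-ccf {n} {c} D no-chains c-colliders = begin
  count fork bs          ≡⟨ m+n∸m≡n c (count fork bs) ⟨
  c + count fork bs ∸ c  ≡⟨ cong (_∸ c) length-bs ⟨
  length bs ∸ c          ≡⟨ cong (_∸ c) (m*n/n≡m (length bs) 4) ⟨
  length bs * 4 / 4 ∸ c  ≡⟨ cong (λ m → m / 4 ∸ c) (length-ccf-blocks D) ⟩
  n * (n ∸ 1) / 4 ∸ c    ∎
  where
  bs : List (Block n)
  bs = CCFDecomposition.blocks D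
  length-bs : length bs ≡ c + count fork bs
  length-bs = trans (length≡counts bs) (cong₂ (λ x y → x + y + count fork bs) no-chains c-colliders)

mainTheorem7 : (n : ℕ) → .{{_ : NonZero n}} → (n % 4 ≡ 0 ⊎ n % 4 ≡ 1) →
    Σ (CCFDecomposition n) λ D →
      (count collider (CCFDecomposition.blocks D) ≡ n / 4)
      × (count fork (CCFDecomposition.blocks D) ≡ (n * (n ∸ 1)) / 4 ∸ n / 4)
      × (count chain (CCFDecomposition.blocks D) ≡ 0)
mainTheorem7 n residue = toCCF D , colliders D , count-fork-ccf (toCCF D) (noChains D) (colliders D) , noChains D
  where
  D : FCDecomposition (ttArcs n) (n / 4)
  D = decomposition n residue
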